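{- Every cubic graph that has a bridge and a perfect matching has a disconnecting perfect matching.
   Context: All graphs are finite and simple; a cubic graph is one in which every vertex has degree $3$. A bridge is an edge whose removal increases the number of connected components. A perfect matching $M$ of $G$ is disconnecting if $G-M$ has more connected components than $G$. -}

module Defs where

open import Data.Nat using (ℕ; _<_)
open import Data.Fin using (Fin)
open import Data.Bool using (Bool; true; false; _∧_; _∨_; not; if_then_else_)
open import Data.List using (List; map; allFin)
open import Data.Nat.ListAction using (sum)
open import Data.Product using (Σ; ∃; _×_; _,_)
open import Data.Sum using (_⊎_)
open import Relation.Binary.PropositionalEquality using (_≡_)

record Graph (n : ℕ) : Set where
  field
    adj   : Fin n → Fin n → Bool
    sym   : ∀ i j → adj i j ≡ adj j i
    irref : ∀ i → adj i i ≡ false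
open Graph public

degreeOf : ∀ {n} → (Fin n → Fin n → Bool) → Fin n → ℕ
degreeOf {n} R i = sum (map (λ j → if R i j then 1 else 0) (allFin n))

Cubic : ∀ {n} → Graph n → Set
Cubic G = ∀ i → degreeOf (adj G) i ≡ 3

data Reach {n} (G : Graph n) : Fin n → Fin n → Set where
  here : ∀ {u} → Reach G u u
  step : ∀ {u v w} → adj G u v ≡ true → Reach G v w → Reach G u w

-- G has exactly k connected components: there is a surjective labelling
-- of the vertices by Fin k whose fibres are exactly the components.
HasComponents : ∀ {n} → Graph n → ℕ → Set
HasComponents {n} G k =
  Σ (Fin n → Fin k) λ f →
    (∀ c → ∃ λ v → f v ≡ c) ×
    (∀ u v → (f u ≡ f v → Reach G u v) × (Reach G u v → f u ≡ f v))

record EdgeSet {n} (G : Graph n) : Set where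
  field
    mem    : Fin n → Fin n → Bool
    memSym : ∀ i j → mem i j ≡ mem j i
    memSub : ∀ i j → mem i j ≡ true → adj G i j ≡ true
open EdgeSet public

_─_ : ∀ {n} (G : Graph n) → EdgeSet G → Graph n
_─_ {n} G E = record
  { adj   = λ i j → adj G i j ∧ not (mem E i j)
  ; sym   = λ i j → sym' i j
  ; irref = λ i → irr i }
  where
  open import Relation.Binary.PropositionalEquality using (cong₂)
  sym' : ∀ i j → (adj G i j ∧ not (mem E i j)) ≡ (adj G j i ∧ not (mem E j i))
  sym' i j = cong₂ (λ a b → a ∧ not b) (Graph.sym G i j) (memSym E i j)
  irr : ∀ i → (adj G i i ∧ not (mem E i i)) ≡ false
  irr i with adj G i i | Graph.irref G i
  ... | .false | _≡_.refl = _≡_.refl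

Disconnects : ∀ {n} (G : Graph n) → EdgeSet G → Set
Disconnects G E = ∃ λ k → ∃ λ k' →
  HasComponents G k × HasComponents (G ─ E) k' × k < k'

HasBridge : ∀ {n} → Graph n → Set
HasBridge {n} G = ∃ λ (u : Fin n) → ∃ λ (v : Fin n) → Σ (EdgeSet G) λ E →
  adj G u v ≡ true ×
  (∀ i j → (mem E i j ≡ true → (i ≡ u × j ≡ v) ⊎ (i ≡ v × j ≡ u)) ×
           ((i ≡ u × j ≡ v) ⊎ (i ≡ v × j ≡ u) → mem E i j ≡ true)) ×
  Disconnects G E

IsPerfectMatching : ∀ {n} (G : Graph n) → EdgeSet G → Set
IsPerfectMatching {n} G M = ∀ i → degreeOf (mem M) i ≡ 1

HasPerfectMatching : ∀ {n} → Graph n → Set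
HasPerfectMatching G = ∃ λ M → IsPerfectMatching G M

HasDisconnectingPerfectMatching : ∀ {n} → Graph n → Set
HasDisconnectingPerfectMatching G = ∃ λ M → IsPerfectMatching G M × Disconnects G M

-- Let uv be a bridge and C the component of u in G - uv. Every edge leaving C
-- is uv. If a perfect matching M avoided uv, then the 2-regular graph G - M
-- would have exactly one edge leaving C; but in a graph with all degrees even
-- every cut is even. So every perfect matching contains the bridge, G - M is a
-- spanning subgraph of G - uv, and hence has at least as many components as
-- G - uv, which has more than G.
{-# OPTIONS --safe #-}
module Submission where

open import Defs hiding (sym)
open import Data.Bool using (Bool; true; false; _∧_; _∨_; not; if_then_else_)
open import Data.Bool.Properties
  using (∧-comm; ∧-zeroʳ; ∧-conicalˡ; ∧-conicalʳ; ∨-zeroʳ; not-injective; not-¬; ¬-not)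
import Data.Bool.Properties as Bool
open import Data.Fin using (Fin; zero; suc; _≟_)
import Data.Fin.Properties as Fin
open import Data.List using (tabulate)
open import Data.List.Properties using (map-tabulate)
import Data.Nat.ListAction as ListAction
open import Data.Nat using (ℕ; zero; suc; _+_; _≤_)
open import Data.Nat.Divisibility
  using (_∣_; _∣0; ∣-refl; m∣m*n; ∣m∣n⇒∣m+n; ∣m+n∣m⇒∣n; ∣1⇒≡1)
open import Data.Nat.Properties
  using (+-*-semiring; +-assoc; +-identityʳ; <-≤-trans; <⇒≱; suc-injective)
open import Data.Product using (Σ; ∃; _×_; _,_; proj₁; proj₂)
open import Data.Sum using (_⊎_; inj₁; inj₂)
open import Function using (_∘_)
open import Relation.Binary.Construct.Closure.ReflexiveTransitive as Star
  using (Star; ε; _◅_; _◅◅_)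
open import Relation.Binary.PropositionalEquality
  using (_≡_; _≢_; refl; sym; trans; cong; cong₂; subst; subst₂; module ≡-Reasoning)
open import Relation.Nullary using (¬_; yes; no; does; contradiction)
open import Relation.Nullary.Decidable using (dec-true; dec-false)

open import Algebra.Properties.Semiring.Sum +-*-semiring
  using (sum; ∑-distrib-+; sum-cong-≗; sum-replicate-zero)

BoolRel : ℕ → Set
BoolRel n = Fin n → Fin n → Bool

Edge : ∀ {n} → BoolRel n → Fin n → Fin n → Set
Edge R i j = R i j ≡ true

Walk : ∀ {n} → BoolRel n → Fin n → Fin n → Set
Walk R = Star (Edge R)

walk-reverse : ∀ {n} {R : BoolRel n} → (∀ i j → R i j ≡ R j i) →
               ∀ {i j} → Walk R i j → Walk R j i
walk-reverse R-sym = Star.reverse (λ {i} {j} e → trans (R-sym j i) e)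

reach⇒walk : ∀ {n} {G : Graph n} {i j} → Reach G i j → Walk (adj G) i j
reach⇒walk here       = ε
reach⇒walk (step e r) = e ◅ reach⇒walk r

walk⇒reach : ∀ {n} {G : Graph n} {i j} → Walk (adj G) i j → Reach G i j
walk⇒reach ε       = here
walk⇒reach (e ◅ w) = step e (walk⇒reach w)

Labelling : ∀ {n} → (Fin n → Fin n → Set) → ℕ → Set
Labelling {n} _~_ k = Σ (Fin n → Fin k) λ f →
  (∀ c → ∃ λ v → f v ≡ c) ×
  (∀ u v → (f u ≡ f v → u ~ v) × (u ~ v → f u ≡ f v))

labelling-cong : ∀ {n k} {_~_ _≈_ : Fin n → Fin n → Set} →
                 (∀ {u v} → u ~ v → u ≈ v) → (∀ {u v} → u ≈ v → u ~ v) →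
                 Labelling _~_ k → Labelling _≈_ k
labelling-cong ~⇒≈ ≈⇒~ (f , onto , classes) =
  f , onto , λ u v → ~⇒≈ ∘ proj₁ (classes u v) , proj₂ (classes u v) ∘ ≈⇒~

labelling-≤ : ∀ {n k l} {_~_ _≈_ : Fin n → Fin n → Set} →
              Labelling _~_ k → Labelling _≈_ l → (∀ {u v} → u ≈ v → u ~ v) → k ≤ l
labelling-≤ {n} {k} (f , onto , f-classes) (g , _ , g-classes) ≈⇒~ =
  Fin.injective⇒≤ g∘rep-injective
  where
  rep : Fin k → Fin n
  rep c = proj₁ (onto c)

  g∘rep-injective : ∀ {c d} → g (rep c) ≡ g (rep d) → c ≡ d
  g∘rep-injective {c} {d} eq = begin
    c         ≡⟨ sym (proj₂ (onto c)) ⟩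
    f (rep c) ≡⟨ proj₂ (f-classes _ _) (≈⇒~ (proj₁ (g-classes _ _) eq)) ⟩
    f (rep d) ≡⟨ proj₂ (onto d) ⟩
    d         ∎
    where open ≡-Reasoning

-- Deleting vertex zero and joining its neighbours pairwise preserves
-- connectivity among the remaining vertices; by induction on the number of
-- vertices this gives a component labelling of every graph.
module VertexElimination {n} (R : BoolRel (suc n)) where

  via-zero : BoolRel n
  via-zero i j = R (suc i) zero ∧ R zero (suc j)

  R⁻ : BoolRel n
  R⁻ i j = R (suc i) (suc j) ∨ via-zero i j

  R⁻-sym : (∀ i j → R i j ≡ R j i) → ∀ i j → R⁻ i j ≡ R⁻ j i
  R⁻-sym R-sym i j = cong₂ _∨_ (R-sym (suc i) (suc j))
    (trans (cong₂ _∧_ (R-sym (suc i) zero) (R-sym zero (suc j)))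
           (∧-comm (R zero (suc i)) (R (suc j) zero)))

  lift-edge : ∀ {i j} → Edge R⁻ i j → Walk R (suc i) (suc j)
  lift-edge {i} {j} e with R (suc i) (suc j) in direct
  ... | true  = direct ◅ ε
  ... | false = ∧-conicalˡ _ _ e ◅ ∧-conicalʳ _ _ e ◅ ε

  lift : ∀ {i j} → Walk R⁻ i j → Walk R (suc i) (suc j)
  lift ε       = ε
  lift (e ◅ w) = lift-edge e ◅◅ lift w

  mutual
    lower : ∀ {i j} → Walk R (suc i) (suc j) → Walk R⁻ i j
    lower ε                         = ε
    lower (_◅_ {j = zero}  e w)     = lower-via-zero e w
    lower {i} (_◅_ {j = suc k} e w) = cong (_∨ via-zero i k) e ◅ lower w

    lower-via-zero : ∀ {i j} → Edge R (suc i) zero → Walk R zero (suc j) → Walk R⁻ i j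
    lower-via-zero e (_◅_ {j = zero}  _  w) = lower-via-zero e w
    lower-via-zero {i} e (_◅_ {j = suc k} e′ w) =
      trans (cong (R (suc i) (suc k) ∨_) (cong₂ _∧_ e e′)) (∨-zeroʳ _) ◅ lower w

  isolated-unreachable : ¬ (∃ λ i → Edge R zero (suc i)) → ∀ {j} → ¬ Walk R zero (suc j)
  isolated-unreachable isolated (_◅_ {j = zero}  _ w) = isolated-unreachable isolated w
  isolated-unreachable isolated (_◅_ {j = suc i} e _) = isolated (i , e)

  module _ (R-sym : ∀ i j → R i j ≡ R j i) {k} (L : Labelling (Walk R⁻) k) where

    private
      f       = proj₁ L
      onto    = proj₁ (proj₂ L)
      classes = proj₂ (proj₂ L)

    labelling-attach : ∀ i₀ → Edge R zero (suc i₀) → Labelling (Walk R) k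
    labelling-attach i₀ e = f ∘ p , (λ c → suc (proj₁ (onto c)) , proj₂ (onto c)) , classes′
      where
      p : Fin (suc n) → Fin n
      p zero    = i₀
      p (suc i) = i

      to-p : ∀ a → Walk R a (suc (p a))
      to-p zero    = e ◅ ε
      to-p (suc a) = ε

      classes′ : ∀ a b → (f (p a) ≡ f (p b) → Walk R a b) × (Walk R a b → f (p a) ≡ f (p b))
      classes′ a b =
        (λ eq → to-p a ◅◅ lift (proj₁ (classes _ _) eq) ◅◅ walk-reverse R-sym (to-p b)) ,
        (λ w → proj₂ (classes _ _) (lower (walk-reverse R-sym (to-p a) ◅◅ w ◅◅ to-p b)))

    labelling-isolated : ¬ (∃ λ i → Edge R zero (suc i)) → Labelling (Walk R) (suc k)
    labelling-isolated isolated = f′ , onto′ , classes′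
      where
      f′ : Fin (suc n) → Fin (suc k)
      f′ zero    = zero
      f′ (suc i) = suc (f i)

      onto′ : ∀ c → ∃ λ v → f′ v ≡ c
      onto′ zero    = zero , refl
      onto′ (suc c) = suc (proj₁ (onto c)) , cong suc (proj₂ (onto c))

      classes′ : ∀ a b → (f′ a ≡ f′ b → Walk R a b) × (Walk R a b → f′ a ≡ f′ b)
      classes′ zero    zero    = (λ _ → ε) , (λ _ → refl)
      classes′ zero    (suc b) = (λ ()) , (λ w → contradiction w (isolated-unreachable isolated))
      classes′ (suc a) zero    =
        (λ ()) , (λ w → contradiction (walk-reverse R-sym w) (isolated-unreachable isolated))
      classes′ (suc a) (suc b) =
        lift ∘ proj₁ (classes a b) ∘ Fin.suc-injective , cong suc ∘ proj₂ (classes a b) ∘ lower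

    labelling-extend : ∃ (Labelling (Walk R))
    labelling-extend with Fin.any? (λ i → R zero (suc i) Bool.≟ true)
    ... | yes (i₀ , e) = k , labelling-attach i₀ e
    ... | no isolated  = suc k , labelling-isolated isolated

walk-labelling : ∀ n (R : BoolRel n) → (∀ i j → R i j ≡ R j i) → ∃ (Labelling (Walk R))
walk-labelling zero    R R-sym = 0 , (λ ()) , (λ ()) , (λ ())
walk-labelling (suc n) R R-sym =
  labelling-extend R-sym (proj₂ (walk-labelling n R⁻ (R⁻-sym R-sym)))
  where open VertexElimination R

has-components : ∀ {n} (G : Graph n) → ∃ (HasComponents G)
has-components {n} G with walk-labelling n (adj G) (Graph.sym G)
... | k , L = k , labelling-cong walk⇒reach reach⇒walk L

indicator : Bool → ℕ
indicator b = if b then 1 else 0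

count : ∀ {n} → (Fin n → Bool) → ℕ
count P = sum (λ j → indicator (P j))

count₂ : ∀ {n} → BoolRel n → ℕ
count₂ Q = sum (λ i → count (Q i))

cut : ∀ {n} → BoolRel n → (Fin n → Bool) → ℕ
cut R C = count₂ (λ i j → C i ∧ (not (C j) ∧ R i j))

sum-tabulate : ∀ {n} (f : Fin n → ℕ) → ListAction.sum (tabulate f) ≡ sum f
sum-tabulate {zero}  f = refl
sum-tabulate {suc n} f = cong (f zero +_) (sum-tabulate (f ∘ suc))

degreeOf≡count : ∀ {n} (R : BoolRel n) i → degreeOf R i ≡ count (R i)
degreeOf≡count R i = trans (cong ListAction.sum (map-tabulate (λ j → j) (indicator ∘ R i)))
                            (sum-tabulate (indicator ∘ R i))

count-false : ∀ {n} {P : Fin n → Bool} → (∀ j → P j ≡ false) → count P ≡ 0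
count-false {n} P-false = trans (sum-cong-≗ (cong indicator ∘ P-false)) (sum-replicate-zero n)

count-split : ∀ {n} (B P : Fin n → Bool) →
              count P ≡ count (λ j → B j ∧ P j) + count (λ j → not (B j) ∧ P j)
count-split B P = trans (sum-cong-≗ pointwise)
  (∑-distrib-+ (λ j → indicator (B j ∧ P j)) (λ j → indicator (not (B j) ∧ P j)))
  where
  pointwise : ∀ j → indicator (P j) ≡ indicator (B j ∧ P j) + indicator (not (B j) ∧ P j)
  pointwise j with B j | P j
  ... | true  | true  = refl
  ... | true  | false = refl
  ... | false | true  = refl
  ... | false | false = refl

sum-δ : ∀ {n} (f : Fin n → ℕ) t → (∀ j → j ≢ t → f j ≡ 0) → sum f ≡ f t
sum-δ {suc n} f zero    off = trans (cong (f zero +_) rest≡0) (+-identityʳ _)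
  where
  rest≡0 : sum (f ∘ suc) ≡ 0
  rest≡0 = trans (sum-cong-≗ λ j → off (suc j) λ ()) (sum-replicate-zero n)
sum-δ {suc n} f (suc t) off = trans (cong (_+ sum (f ∘ suc)) (off zero λ ())) (sum-δ (f ∘ suc) t off′)
  where
  off′ : ∀ j → j ≢ t → f (suc j) ≡ 0
  off′ j j≢t = off (suc j) (j≢t ∘ Fin.suc-injective)

count₂-singleton : ∀ {n} {Q : BoolRel n} {u v} →
                   (∀ {i j} → Q i j ≡ true → i ≡ u × j ≡ v) → Q u v ≡ true → count₂ Q ≡ 1
count₂-singleton {Q = Q} {u} {v} only Quv = begin
  count₂ Q          ≡⟨ sum-δ _ u (λ i i≢u → count-false {P = Q i} λ j → ¬-not (i≢u ∘ proj₁ ∘ only)) ⟩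
  count (Q u)       ≡⟨ sum-δ _ v (λ j j≢v → cong indicator (¬-not (j≢v ∘ proj₂ ∘ only))) ⟩
  indicator (Q u v) ≡⟨ cong indicator Quv ⟩
  1                 ∎
  where open ≡-Reasoning

sum-even : ∀ {n} (f : Fin n → ℕ) → (∀ i → 2 ∣ f i) → 2 ∣ sum f
sum-even {zero}  f even = 2 ∣0
sum-even {suc n} f even = ∣m∣n⇒∣m+n (even zero) (sum-even (f ∘ suc) (even ∘ suc))

count₂-even : ∀ {n} (Q : BoolRel n) → (∀ i j → Q i j ≡ Q j i) → (∀ i → Q i i ≡ false) →
              2 ∣ count₂ Q
count₂-even {zero}  Q Q-sym Q-irr = 2 ∣0
count₂-even {suc n} Q Q-sym Q-irr =
  subst (2 ∣_) (sym split) (2∣m+[m+n] A (count₂-even Q⁺ (λ i j → Q-sym (suc i) (suc j)) (Q-irr ∘ suc)))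
  where
  A : ℕ
  A = count (λ j → Q zero (suc j))

  Q⁺ : BoolRel n
  Q⁺ i j = Q (suc i) (suc j)

  split : count₂ Q ≡ A + (A + count₂ Q⁺)
  split = begin
    count₂ Q
      ≡⟨ cong₂ _+_ (cong (λ b → indicator b + A) (Q-irr zero))
                   (∑-distrib-+ (λ i → indicator (Q (suc i) zero)) (count ∘ Q⁺)) ⟩
    A + (sum (λ i → indicator (Q (suc i) zero)) + count₂ Q⁺)
      ≡⟨ cong (λ x → A + (x + count₂ Q⁺)) (sum-cong-≗ (λ i → cong indicator (Q-sym (suc i) zero))) ⟩
    A + (A + count₂ Q⁺) ∎
    where open ≡-Reasoning

  2∣m+[m+n] : ∀ m {n} → 2 ∣ n → 2 ∣ m + (m + n)
  2∣m+[m+n] m 2∣n = subst (2 ∣_) (+-assoc m m _)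
    (∣m∣n⇒∣m+n (subst (2 ∣_) (cong (m +_) (+-identityʳ m)) (m∣m*n m)) 2∣n)

even-degrees⇒even-cut : ∀ {n} (R : BoolRel n) → (∀ i j → R i j ≡ R j i) → (∀ i → R i i ≡ false) →
                        (∀ i → 2 ∣ count (R i)) → ∀ C → 2 ∣ cut R C
even-degrees⇒even-cut {n} R R-sym R-irr even C =
  ∣m+n∣m⇒∣n (subst (2 ∣_) split (sum-even _ even-on-C)) (count₂-even inside inside-sym inside-irr)
  where
  inside : BoolRel _
  inside i j = (C i ∧ C j) ∧ R i j

  inside-sym : ∀ i j → inside i j ≡ inside j i
  inside-sym i j = cong₂ _∧_ (∧-comm (C i) (C j)) (R-sym i j)

  inside-irr : ∀ i → inside i i ≡ false
  inside-irr i = trans (cong ((C i ∧ C i) ∧_) (R-irr i)) (∧-zeroʳ _)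

  degree-on-C : ∀ i → ℕ
  degree-on-C i = if C i then count (R i) else 0

  even-on-C : ∀ i → 2 ∣ degree-on-C i
  even-on-C i with C i
  ... | true  = even i
  ... | false = 2 ∣0

  split : sum degree-on-C ≡ count₂ inside + cut R C
  split = trans (sum-cong-≗ pointwise)
    (∑-distrib-+ (count ∘ inside) (λ i → count (λ j → C i ∧ (not (C j) ∧ R i j))))
    where
    pointwise : ∀ i → degree-on-C i ≡ count (inside i) + count (λ j → C i ∧ (not (C j) ∧ R i j))
    pointwise i with C i
    ... | true  = count-split C (R i)
    ... | false = sym (cong₂ _+_ count-none count-none)
      where
      count-none : count {n} (λ _ → false) ≡ 0
      count-none = count-false {n} {λ _ → false} λ _ → refl

WithinEdge : ∀ {n} {G : Graph n} → EdgeSet G → Fin n → Fin n → Set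
WithinEdge E u v = ∀ i j → mem E i j ≡ true → (i ≡ u × j ≡ v) ⊎ (i ≡ v × j ≡ u)

OnlyEdgeLeaving : ∀ {n} → BoolRel n → (Fin n → Bool) → Fin n → Fin n → Set
OnlyEdgeLeaving R C u v = ∀ {i j} → C i ≡ true → C j ≡ false → R i j ≡ true → i ≡ u × j ≡ v

module _ {n} {G : Graph n} where

  ─-edge : ∀ (E : EdgeSet G) {i j} → adj G i j ≡ true → mem E i j ≡ false → adj (G ─ E) i j ≡ true
  ─-edge E e m = subst₂ (λ a b → a ∧ not b ≡ true) (sym e) (sym m) refl

  ─-⊆ : ∀ {E : EdgeSet G} {i j} → adj (G ─ E) i j ≡ true → adj G i j ≡ true
  ─-⊆ = ∧-conicalˡ _ _

  ─-antitone : ∀ {E F : EdgeSet G} → (∀ {i j} → mem E i j ≡ true → mem F i j ≡ true) →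
               ∀ {i j} → adj (G ─ F) i j ≡ true → adj (G ─ E) i j ≡ true
  ─-antitone {E} {F} E⊆F {i} {j} e = ─-edge E (─-⊆ {F} e) ij∉E
    where
    ij∉E : mem E i j ≡ false
    ij∉E = ¬-not (λ ij∈E → not-¬ (E⊆F ij∈E) (not-injective {y = false} (∧-conicalʳ _ _ e)))

  within-edge-⊆ : ∀ {E : EdgeSet G} {u v} → WithinEdge E u v → (M : EdgeSet G) → mem M u v ≡ true →
                  ∀ {i j} → mem E i j ≡ true → mem M i j ≡ true
  within-edge-⊆ within M uv∈M {i} {j} e with within i j e
  ... | inj₁ (refl , refl) = uv∈M
  ... | inj₂ (refl , refl) = trans (memSym M _ _) uv∈M

  module _ {E : EdgeSet G} {u v} (within : WithinEdge E u v) where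

    reroute-edge : Walk (adj (G ─ E)) u v → ∀ {i j} → Edge (adj G) i j → Walk (adj (G ─ E)) i j
    reroute-edge u~v {i} {j} e with mem E i j in m
    ... | false = ─-edge E e m ◅ ε
    ... | true with within i j m
    ...   | inj₁ (refl , refl) = u~v
    ...   | inj₂ (refl , refl) = walk-reverse (Graph.sym (G ─ E)) u~v

    bridge-ends-disconnected : Disconnects G E → ¬ Walk (adj (G ─ E)) u v
    bridge-ends-disconnected (k , k′ , G-comps , G─E-comps , k<k′) u~v =
      <⇒≱ k<k′ (labelling-≤ G─E-comps G-comps reroute)
      where
      reroute : ∀ {a b} → Reach G a b → Reach (G ─ E) a b
      reroute = walk⇒reach ∘ Star.concat ∘ Star.map (reroute-edge u~v) ∘ reach⇒walk

    bridge-only-edge-leaving : ¬ Walk (adj (G ─ E)) u v → ∀ {k} → HasComponents (G ─ E) k →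
      Σ (Fin n → Bool) λ C → C u ≡ true × C v ≡ false × OnlyEdgeLeaving (adj G) C u v
    bridge-only-edge-leaving u≁v (f , _ , classes) = C , dec-true (f u ≟ f u) refl , Cv , only
      where
      C : Fin n → Bool
      C w = does (f w ≟ f u)

      C-sound : ∀ {w} → C w ≡ true → f w ≡ f u
      C-sound {w} Cw with f w ≟ f u
      ... | yes eq = eq

      Cv : C v ≡ false
      Cv = dec-false (f v ≟ f u) (λ eq → u≁v (reach⇒walk (proj₁ (classes u v) (sym eq))))

      only : OnlyEdgeLeaving (adj G) C u v
      only {i} {j} Ci Cj e with mem E i j in m
      ... | false = contradiction Cj (not-¬ (dec-true (f j ≟ f u) f-j≡f-u))
        where
        f-j≡f-u : f j ≡ f u
        f-j≡f-u = trans (sym (proj₂ (classes i j) (step (─-edge E e m) here))) (C-sound Ci)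
      ... | true with within i j m
      ...   | inj₁ ij≡uv          = ij≡uv
      ...   | inj₂ (refl , refl) = contradiction Ci (not-¬ Cv)

cut≡1 : ∀ {n} {R : BoolRel n} {C u v} → OnlyEdgeLeaving R C u v →
        C u ≡ true → C v ≡ false → R u v ≡ true → cut R C ≡ 1
cut≡1 {R = R} {C} {u} {v} only Cu Cv e = count₂-singleton leaving uv-leaves
  where
  leaving : ∀ {i j} → C i ∧ (not (C j) ∧ R i j) ≡ true → i ≡ u × j ≡ v
  leaving {i} {j} l = only (∧-conicalˡ (C i) _ l)
                           (not-injective {y = false} (∧-conicalˡ (not (C j)) (R i j) outward))
                           (∧-conicalʳ (not (C j)) (R i j) outward)
    where
    outward : not (C j) ∧ R i j ≡ true
    outward = ∧-conicalʳ (C i) (not (C j) ∧ R i j) l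

  uv-leaves : C u ∧ (not (C v) ∧ R u v) ≡ true
  uv-leaves rewrite Cu | Cv | e = refl

module _ {n} {G : Graph n} (cubic : Cubic G) (M : EdgeSet G) (perfect : IsPerfectMatching G M) where

  ─-perfect-matching-2-regular : ∀ i → count (adj (G ─ M) i) ≡ 2
  ─-perfect-matching-2-regular i = sym (suc-injective (begin
    3
      ≡⟨ trans (sym (cubic i)) (degreeOf≡count (adj G) i) ⟩
    count (adj G i)
      ≡⟨ count-split (mem M i) (adj G i) ⟩
    count (λ j → mem M i j ∧ adj G i j) + count (λ j → not (mem M i j) ∧ adj G i j)
      ≡⟨ cong₂ _+_ (sum-cong-≗ (cong indicator ∘ M∧G≡M))
                   (sum-cong-≗ (λ j → cong indicator (∧-comm (not (mem M i j)) (adj G i j)))) ⟩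
    count (mem M i) + count (adj (G ─ M) i)
      ≡⟨ cong (_+ count (adj (G ─ M) i)) (trans (sym (degreeOf≡count (mem M) i)) (perfect i)) ⟩
    1 + count (adj (G ─ M) i) ∎))
    where
    open ≡-Reasoning

    M∧G≡M : ∀ j → mem M i j ∧ adj G i j ≡ mem M i j
    M∧G≡M j with mem M i j in m
    ... | false = refl
    ... | true  = memSub M i j m

  perfect-matching-contains-only-edge-leaving : ∀ {C u v} → OnlyEdgeLeaving (adj G) C u v →
    C u ≡ true → C v ≡ false → adj G u v ≡ true → mem M u v ≡ true
  perfect-matching-contains-only-edge-leaving {C} {u} {v} only Cu Cv uv∈G =
    ¬-not λ uv∉M → 2≢1 (∣1⇒≡1 (subst (2 ∣_) (cut≡1 only′ Cu Cv (─-edge M uv∈G uv∉M)) even-cut))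
    where
    only′ : OnlyEdgeLeaving (adj (G ─ M)) C u v
    only′ Ci Cj e = only Ci Cj (─-⊆ {E = M} e)

    even-cut : 2 ∣ cut (adj (G ─ M)) C
    even-cut = even-degrees⇒even-cut (adj (G ─ M)) (Graph.sym (G ─ M)) (irref (G ─ M))
                 (λ i → subst (2 ∣_) (sym (─-perfect-matching-2-regular i)) ∣-refl) C

    2≢1 : 2 ≢ 1
    2≢1 ()

lemma14 : ∀ (n : ℕ) (G : Graph n) → Cubic G → HasBridge G → HasPerfectMatching G →
    HasDisconnectingPerfectMatching G
lemma14 n G cubic (u , v , E , uv∈G , E≡uv , disconnects@(k , k′ , G-comps , G─E-comps , k<k′))
        (M , perfect) =
  M , perfect , k , k″ , G-comps , G─M-comps , <-≤-trans k<k′ k′≤k″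
  where
  within : WithinEdge E u v
  within i j = proj₁ (E≡uv i j)

  uv∈M : mem M u v ≡ true
  uv∈M with bridge-only-edge-leaving within (bridge-ends-disconnected within disconnects) G─E-comps
  ... | C , Cu , Cv , only =
    perfect-matching-contains-only-edge-leaving cubic M perfect only Cu Cv uv∈G

  k″ : ℕ
  k″ = proj₁ (has-components (G ─ M))

  G─M-comps : HasComponents (G ─ M) k″
  G─M-comps = proj₂ (has-components (G ─ M))

  G─M⊆G─E : ∀ {i j} → adj (G ─ M) i j ≡ true → adj (G ─ E) i j ≡ true
  G─M⊆G─E = ─-antitone {E = E} {F = M} (within-edge-⊆ {E = E} within M uv∈M)

  k′≤k″ : k′ ≤ k″
  k′≤k″ = labelling-≤ G─E-comps G─M-comps (walk⇒reach ∘ Star.map G─M⊆G─E ∘ reach⇒walk)
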